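{- Let $(X,\Delta)$ be an abstract simplicial complex on a finite ground set $X$ with $|X|=n$. Suppose that for every integer $k$ with $1\le k<\operatorname{rk}(\Delta)$, every vertex of the combinatorial atlas $\mathcal{A}(\Delta,k)$ is hyperbolic. Then $\Delta$ is a matroid, i.e. for all $S,T\in\Delta$ with $|S|<|T|$ there exists $y\in T\setminus S$ with $S\cup\{y\}\in\Delta$.
   Context: An abstract simplicial complex is a pair $(X,\Delta)$ with $\Delta\subseteq 2^X$ such that $S\subset T\in\Delta$ implies $S\in\Delta$; elements of $\Delta$ are faces and $\operatorname{rk}(\Delta)$ is the largest cardinality of a face. $X^*$ is the set of finite words over $X$. A word is feasible if no letter repeats and its set of letters lies in $\Delta$; $\mathcal{L}$ is the set of feasible words. For $\beta\in X^*$, $j\ge0$: $\operatorname{Cnt}_j(\beta)=\{\gamma\in X^*:|\gamma|=j,\ \beta\gamma\in\mathcal{L}\}$. $\bar X=X\cup\{\ast\}$ ($\ast$ a new symbol); vectors/matrices are indexed by $\bar X$. For $\alpha\in X^*$ and $m\ge1$, $\mathbf{A}(\alpha,m)$ is the $\bar X\times\bar X$ matrix with $A_{xy}=|\operatorname{Cnt}_{m-1}(\alpha xy)|$ ($x,y\in X$), $A_{x\ast}=A_{\ast x}=|\operatorname{Cnt}_{m-1}(\alpha x)|$ ($x\in X$), $A_{\ast\ast}=|\operatorname{Cnt}_{m-1}(\alpha)|$. The atlas $\mathcal{A}(\Delta,k)$ has vertices $(\alpha,m,t)$ with $1\le m\le k-1$, $\alpha\in X^*$, $|\alpha|\le k-1-m$,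 $t\in[0,1]$, with associated matrix $t\mathbf{A}(\alpha,m+1)+(1-t)\mathbf{A}(\alpha,m)$, and vertices $(\alpha,0,1)$ with $|\alpha|\le k-1$, with associated matrix $\mathbf{A}(\alpha,1)$. A vertex is hyperbolic if its associated matrix $\mathbf{M}$ satisfies $\langle\mathbf{v},\mathbf{M}\mathbf{w}\rangle^2\ge\langle\mathbf{v},\mathbf{M}\mathbf{v}\rangle\langle\mathbf{w},\mathbf{M}\mathbf{w}\rangle$ for all $\mathbf{v},\mathbf{w}\in\mathbb{R}^{\bar X}$ with $\langle\mathbf{w},\mathbf{M}\mathbf{w}\rangle>0$. -}

module Defs where

open import Data.Nat as ℕ using (ℕ; zero; suc; _∸_)
open import Data.Bool using (Bool; true; false; _∧_; not)
open import Data.Fin using (Fin)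
open import Data.Fin.Properties using (_≟_)
open import Data.Fin.Subset using (Subset; ⁅_⁆; _∪_; ⊥; _⊆_; _∈_; _∉_; ∣_∣)
open import Data.List using (List; []; _∷_; _++_; [_]; length; map; concatMap; allFin; filter; foldr)
open import Data.Maybe using (Maybe; just; nothing)
open import Data.Integer using (+_)
open import Data.Rational using (ℚ; _/_; _+_; _*_; _-_; _≤_; _<_; 0ℚ; 1ℚ)
open import Data.Product using (Σ; _×_; ∃; ∃-syntax)
open import Relation.Nullary.Decidable using (⌊_⌋)
open import Relation.Binary.PropositionalEquality using (_≡_)

-- An abstract simplicial complex on the ground set X = Fin n is given by
-- the (decidable) membership predicate Δ : Subset n → Bool,
-- "S is a face" meaning Δ S ≡ true.
Complex : ℕ → Set
Complex n = Subset n → Bool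

IsSimplicialComplex : {n : ℕ} → Complex n → Set
IsSimplicialComplex {n} Δ = (S T : Subset n) → S ⊆ T → Δ T ≡ true → Δ S ≡ true

Word : ℕ → Set
Word n = List (Fin n)

letters : {n : ℕ} → Word n → Subset n
letters = foldr (λ x s → ⁅ x ⁆ ∪ s) ⊥

elemB : {n : ℕ} → Fin n → Word n → Bool
elemB x [] = false
elemB x (y ∷ ys) with ⌊ x ≟ y ⌋
... | true = true
... | false = elemB x ys

noRepeat : {n : ℕ} → Word n → Bool
noRepeat [] = true
noRepeat (x ∷ xs) = not (elemB x xs) ∧ noRepeat xs

feasible : {n : ℕ} → Complex n → Word n → Bool
feasible Δ w = noRepeat w ∧ Δ (letters w)

wordsOfLength : {n : ℕ} → ℕ → List (Word n)
wordsOfLength zero = [] ∷ []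
wordsOfLength {n} (suc j) = concatMap (λ x → map (x ∷_) (wordsOfLength j)) (allFin n)

cnt : {n : ℕ} → Complex n → ℕ → Word n → ℕ
cnt Δ j β = length (filter (λ γ → Data.Bool._≟_ (feasible Δ (β ++ γ)) true) (wordsOfLength j))
  where import Data.Bool

-- X̄ = X ∪ {∗}, with ∗ = nothing
Xbar : ℕ → Set
Xbar n = Maybe (Fin n)

allXbar : (n : ℕ) → List (Xbar n)
allXbar n = nothing ∷ map just (allFin n)

ℕtoℚ : ℕ → ℚ
ℕtoℚ k = + k / 1

Matrix : ℕ → Set
Matrix n = Xbar n → Xbar n → ℚ

-- A(α, m), used for m ≥ 1 (entries use Cnt_{m-1})
Amat : {n : ℕ} → Complex n → Word n → ℕ → Matrix n
Amat Δ α m (just x) (just y) = ℕtoℚ (cnt Δ (m ∸ 1) (α ++ (x ∷ y ∷ [])))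
Amat Δ α m (just x) nothing  = ℕtoℚ (cnt Δ (m ∸ 1) (α ++ [ x ]))
Amat Δ α m nothing  (just y) = ℕtoℚ (cnt Δ (m ∸ 1) (α ++ [ y ]))
Amat Δ α m nothing  nothing  = ℕtoℚ (cnt Δ (m ∸ 1) α)

mix : {n : ℕ} → ℚ → Matrix n → Matrix n → Matrix n
mix t M N a b = t * M a b + (1ℚ - t) * N a b

sumℚ : List ℚ → ℚ
sumℚ = foldr _+_ 0ℚ

bilin : {n : ℕ} → Matrix n → (Xbar n → ℚ) → (Xbar n → ℚ) → ℚ
bilin {n} M v w = sumℚ (map (λ a → sumℚ (map (λ b → v a * M a b * w b) (allXbar n))) (allXbar n))

-- hyperbolic matrix (vectors with rational coordinates)
Hyperbolic : {n : ℕ} → Matrix n → Set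
Hyperbolic {n} M = (v w : Xbar n → ℚ) → 0ℚ < bilin M w w →
  bilin M v v * bilin M w w ≤ bilin M v w * bilin M v w

AtlasHyperbolic : {n : ℕ} → Complex n → ℕ → Set
AtlasHyperbolic {n} Δ k =
  ((α : Word n) (m : ℕ) (t : ℚ) → 1 ℕ.≤ m → m ℕ.≤ k ∸ 1 → length α ℕ.≤ k ∸ 1 ∸ m →
     0ℚ ≤ t → t ≤ 1ℚ → Hyperbolic (mix t (Amat Δ α (suc m)) (Amat Δ α m)))
  × ((α : Word n) → length α ℕ.≤ k ∸ 1 → Hyperbolic (Amat Δ α 1))

-- k < rk(Δ)  (rk = largest cardinality of a face)
BelowRank : {n : ℕ} → Complex n → ℕ → Set
BelowRank {n} Δ k = Σ (Subset n) λ T → Δ T ≡ true × k ℕ.< ∣ T ∣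

IsMatroid : {n : ℕ} → Complex n → Set
IsMatroid {n} Δ = (S T : Subset n) → Δ S ≡ true → Δ T ≡ true → ∣ S ∣ ℕ.< ∣ T ∣ →
  ∃[ y ] (y ∈ T × y ∉ S × Δ (S ∪ ⁅ y ⁆) ≡ true)

module Submission where

-- If Δ is not a matroid, take faces S, T with |S| < |T| such that T does not augment S, and descend on
-- |S ∖ T|: remove some s ∈ S ∖ T, and add elements of T as long as that keeps the set a face. Either the
-- pair stays stuck with a smaller |S ∖ T|, or T augments S - s twice in a row, by t and then by u. In the
-- latter case G = S - s gives faces G + s and G + t + u while G + s + t and G + s + u are not faces.
-- For α a word listing G, the principal submatrix of A(α, 1) on (∗, s, t, u) is then the 0/1 matrix
-- obstructionPattern, and v = (1, 1, -1, -1), w = (1, 0, 0, 0) give ⟨v,v⟩⟨w,w⟩ = 1 > 0 = ⟨v,w⟩².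
-- Hyperbolicity passes to principal submatrices, so the atlas vertex (α, 0, 1) of 𝒜(Δ, |G| + 1) is not
-- hyperbolic, although the face G + t + u shows |G| + 1 < rk Δ.

open import Defs
open import Data.Nat using (ℕ; zero; suc; _≤_; _<_; s≤s; z≤n)
import Data.Nat as ℕ
open import Data.Nat.Properties using (≤-trans; ≤-<-trans; <⇒≱; n≤1+n; +-suc; +-comm; ≤-reflexive; +-monoʳ-≤)
open import Data.Nat.Induction using (<-wellFounded)
open import Induction.WellFounded using (Acc; acc)
open import Data.Bool using (Bool; true; false; not; _∧_; if_then_else_)
import Data.Bool as Bool
open import Data.Bool.Properties using (¬-not)
open import Data.Fin using (Fin; zero; suc)
open import Data.Fin.Properties using (any?; _≟_; suc-injective; 0≢1+n)
open import Data.Fin.Subset using (Subset; ⁅_⁆; _∪_; _─_; _-_; _⊆_; _∈_; _∉_; ∣_∣; inside; outside)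
open import Data.Fin.Subset.Properties
open import Data.Maybe using (nothing; just)
open import Data.Maybe.Properties using (just-injective) renaming (≡-dec to ≡-dec-Maybe)
open import Data.Vec using (Vec; []; _∷_; here; there; lookup)
open import Data.Vec.Relation.Unary.All using ([]; _∷_)
open import Data.Vec.Relation.Unary.AllPairs using ([]; _∷_)
open import Data.Vec.Relation.Unary.Unique.Propositional.Properties using (lookup-injective)
open import Data.List using (List; []; _∷_; _++_; [_]; map; tabulate; filter; allFin; length)
open import Data.List.Properties using (map-cong-local; tabulate-cong; ++-identityʳ)
open import Data.List.Membership.Propositional using () renaming (_∈_ to _∈ₗ_)
open import Data.List.Membership.Propositional.Properties using (∈-map⁺; ∈-allFin; ∈-filter⁺; ∈-filter⁻)
open import Data.List.Relation.Unary.Any using (here; there)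
open import Data.List.Relation.Unary.All as All using (All; []; _∷_; all?)
open import Data.List.Relation.Unary.All.Properties using (map⁺)
open import Data.List.Relation.Unary.Unique.Propositional using (Unique; []; _∷_)
import Data.List.Relation.Unary.Unique.Propositional.Properties as Unique
import Data.List.Relation.Unary.Unique.DecPropositional as UniqueDec
open import Data.List.Relation.Binary.Disjoint.Propositional using (Disjoint)
open import Data.Rational using (ℚ; 0ℚ; 1ℚ; -_; _+_; _*_)
import Data.Rational as ℚ
open import Data.Rational.Properties using (+-identityˡ; *-zeroˡ; *-zeroʳ; +-0-commutativeMonoid; <-irrefl; <-≤-trans; positive⁻¹)
open import Algebra.Bundles using (CommutativeMonoid)
open import Algebra.Properties.CommutativeSemigroup (CommutativeMonoid.commutativeSemigroup +-0-commutativeMonoid) using (x∙yz≈y∙xz)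
open import Data.Product using (∃-syntax; _×_; _,_; proj₂)
open import Data.Sum using (_⊎_; inj₁; inj₂)
open import Data.Empty using (⊥-elim)
open import Function using (_∘_)
open import Function.Definitions using (Injective)
open import Relation.Nullary using (¬_; Dec; yes; no; does; contradiction)
open import Relation.Nullary.Decidable using (_×-dec_; ¬?; dec-true; dec-false; decidable-stable)
open import Relation.Binary.Definitions using (DecidableEquality)
open import Relation.Binary.PropositionalEquality hiding ([_])

module _ {A : Set} (_≟ᴬ_ : DecidableEquality A) where

  erase : A → (A → ℚ) → A → ℚ
  erase a f x = if does (x ≟ᴬ a) then 0ℚ else f x

  erase-self : ∀ a f → erase a f a ≡ 0ℚ
  erase-self a f rewrite dec-true (a ≟ᴬ a) refl = refl

  erase-other : ∀ {a x} f → x ≢ a → erase a f x ≡ f x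
  erase-other {a} {x} f x≢a rewrite dec-false (x ≟ᴬ a) x≢a = refl

  sum-erase : ∀ {a xs} f → Unique xs → a ∈ₗ xs →
    sumℚ (map f xs) ≡ f a + sumℚ (map (erase a f) xs)
  sum-erase {xs = x ∷ xs} f (x∉xs ∷ _) (here refl) = cong (f x +_) (sym (begin
    erase x f x + sumℚ (map (erase x f) xs)
      ≡⟨ cong₂ _+_ (erase-self x f)
           (cong sumℚ (map-cong-local (All.map (λ x≢y → erase-other f (x≢y ∘ sym)) x∉xs))) ⟩
    0ℚ + sumℚ (map f xs)
      ≡⟨ +-identityˡ _ ⟩
    sumℚ (map f xs) ∎))
    where open ≡-Reasoning
  sum-erase {a} {x ∷ xs} f (x∉xs ∷ xs!) (there a∈xs) = begin
    f x + sumℚ (map f xs)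
      ≡⟨ cong (f x +_) (sum-erase f xs! a∈xs) ⟩
    f x + (f a + sumℚ (map (erase a f) xs))
      ≡⟨ x∙yz≈y∙xz (f x) (f a) _ ⟩
    f a + (f x + sumℚ (map (erase a f) xs))
      ≡⟨ cong (λ y → f a + (y + _)) (sym (erase-other f (All.lookup x∉xs a∈xs))) ⟩
    f a + (erase a f x + sumℚ (map (erase a f) xs)) ∎
    where open ≡-Reasoning

  sum-zero : ∀ {f : A → ℚ} xs → (∀ x → f x ≡ 0ℚ) → sumℚ (map f xs) ≡ 0ℚ
  sum-zero [] _ = refl
  sum-zero (x ∷ xs) f≡0 = trans (cong₂ _+_ (f≡0 x) (sum-zero xs f≡0)) (+-identityˡ 0ℚ)

  sum-support : ∀ {k xs} f (e : Fin k → A) → Injective _≡_ _≡_ e → Unique xs → (∀ i → e i ∈ₗ xs) →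
    (∀ a → (∀ i → e i ≢ a) → f a ≡ 0ℚ) → sumℚ (map f xs) ≡ sumℚ (tabulate (f ∘ e))
  sum-support {zero} {xs} f e _ _ _ f-off = sum-zero xs (λ a → f-off a (λ ()))
  sum-support {suc k} {xs} f e e-inj xs! e∈xs f-off = begin
    sumℚ (map f xs)
      ≡⟨ sum-erase f xs! (e∈xs zero) ⟩
    f (e zero) + sumℚ (map (erase (e zero) f) xs)
      ≡⟨ cong (f (e zero) +_) (sum-support _ (e ∘ suc) (suc-injective ∘ e-inj) xs! (e∈xs ∘ suc) erased-off) ⟩
    f (e zero) + sumℚ (tabulate (erase (e zero) f ∘ e ∘ suc))
      ≡⟨ cong (λ l → f (e zero) + sumℚ l)
           (tabulate-cong (λ i → erase-other f (λ eq → 0≢1+n (sym (e-inj {suc i} {zero} eq))))) ⟩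
    f (e zero) + sumℚ (tabulate (f ∘ e ∘ suc)) ∎
    where
    open ≡-Reasoning
    erased-off : ∀ a → (∀ i → e (suc i) ≢ a) → erase (e zero) f a ≡ 0ℚ
    erased-off a a∉ with a ≟ᴬ e zero
    ... | yes _ = refl
    ... | no a≢e₀ = f-off a λ { zero → a≢e₀ ∘ sym ; (suc i) → a∉ i }

  extend : ∀ {k} → (Fin k → A) → (Fin k → ℚ) → A → ℚ
  extend e v a with any? (λ i → e i ≟ᴬ a)
  ... | yes (i , _) = v i
  ... | no _ = 0ℚ

  extend-∘ : ∀ {k} {e : Fin k → A} v → Injective _≡_ _≡_ e → ∀ i → extend e v (e i) ≡ v i
  extend-∘ {e = e} v e-inj i with any? (λ j → e j ≟ᴬ e i)
  ... | yes (j , eⱼ≡eᵢ) = cong v (e-inj eⱼ≡eᵢ)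
  ... | no ∄ = contradiction (i , refl) ∄

  extend-off : ∀ {k} {e : Fin k → A} v {a} → (∀ i → e i ≢ a) → extend e v a ≡ 0ℚ
  extend-off {e = e} v {a} a∉ with any? (λ i → e i ≟ᴬ a)
  ... | yes (i , eᵢ≡a) = contradiction eᵢ≡a (a∉ i)
  ... | no _ = refl

_≟X_ : ∀ {n} → DecidableEquality (Xbar n)
_≟X_ = ≡-dec-Maybe _≟_

allXbar-unique : ∀ n → Unique (allXbar n)
allXbar-unique n = map⁺ (All.universal (λ _ ()) _) ∷ Unique.map⁺ just-injective (Unique.allFin⁺ n)

∈-allXbar : ∀ {n} (a : Xbar n) → a ∈ₗ allXbar n
∈-allXbar nothing = here refl
∈-allXbar (just x) = there (∈-map⁺ just (∈-allFin x))

form : ∀ {k} → (Fin k → Fin k → ℚ) → (Fin k → ℚ) → (Fin k → ℚ) → ℚ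
form A v w = sumℚ (tabulate λ i → sumℚ (tabulate λ j → v i * A i j * w j))

HyperbolicForm : ∀ {k} → (Fin k → Fin k → ℚ) → Set
HyperbolicForm A = ∀ v w → 0ℚ ℚ.< form A w w →
  form A v v * form A w w ℚ.≤ form A v w * form A v w

module _ {n k} (M : Matrix n) {e : Fin k → Xbar n} (e-inj : Injective _≡_ _≡_ e) where

  private
    sum-allXbar : ∀ f → (∀ a → (∀ i → e i ≢ a) → f a ≡ 0ℚ) →
      sumℚ (map f (allXbar n)) ≡ sumℚ (tabulate (f ∘ e))
    sum-allXbar f = sum-support _≟X_ f e e-inj (allXbar-unique n) (∈-allXbar ∘ e)

  bilin-extend : ∀ {A} → (∀ i j → M (e i) (e j) ≡ A i j) → ∀ v w →
    bilin M (extend _≟X_ e v) (extend _≟X_ e w) ≡ form A v w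
  bilin-extend {A} M≡A v w = begin
    bilin M v̂ ŵ
      ≡⟨ sum-allXbar (λ a → sumℚ (map (λ b → v̂ a * M a b * ŵ b) (allXbar n))) row-off ⟩
    sumℚ (tabulate λ i → sumℚ (map (λ b → v̂ (e i) * M (e i) b * ŵ b) (allXbar n)))
      ≡⟨ cong sumℚ (tabulate-cong λ i → sum-allXbar (λ b → v̂ (e i) * M (e i) b * ŵ b) (λ b b∉ →
           trans (cong (v̂ (e i) * M (e i) b *_) (extend-off _≟X_ w b∉)) (*-zeroʳ (v̂ (e i) * M (e i) b)))) ⟩
    sumℚ (tabulate λ i → sumℚ (tabulate λ j → v̂ (e i) * M (e i) (e j) * ŵ (e j)))
      ≡⟨ cong sumℚ (tabulate-cong λ i → cong sumℚ (tabulate-cong λ j →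
           cong₂ _*_ (cong₂ _*_ (extend-∘ _≟X_ v e-inj i) (M≡A i j)) (extend-∘ _≟X_ w e-inj j))) ⟩
    form A v w ∎
    where
    open ≡-Reasoning
    v̂ = extend _≟X_ e v
    ŵ = extend _≟X_ e w
    row-off : ∀ a → (∀ i → e i ≢ a) → sumℚ (map (λ b → v̂ a * M a b * ŵ b) (allXbar n)) ≡ 0ℚ
    row-off a a∉ = sum-zero _≟X_ (allXbar n) λ b → begin
      v̂ a * M a b * ŵ b ≡⟨ cong (λ x → x * M a b * ŵ b) (extend-off _≟X_ v a∉) ⟩
      0ℚ * M a b * ŵ b  ≡⟨ cong (_* ŵ b) (*-zeroˡ (M a b)) ⟩
      0ℚ * ŵ b          ≡⟨ *-zeroˡ (ŵ b) ⟩
      0ℚ                ∎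

  restrict-hyperbolic : ∀ {A} → Hyperbolic M → (∀ i j → M (e i) (e j) ≡ A i j) → HyperbolicForm A
  restrict-hyperbolic M-hyp M≡A v w 0<wAw =
    subst₂ ℚ._≤_ (cong₂ _*_ vMv wMw) (cong₂ _*_ vMw vMw)
      (M-hyp (extend _≟X_ e v) (extend _≟X_ e w) (subst (0ℚ ℚ.<_) (sym wMw) 0<wAw))
    where
    vMv = bilin-extend M≡A v v
    vMw = bilin-extend M≡A v w
    wMw = bilin-extend M≡A w w

wordOf : ∀ {n} → Subset n → Word n
wordOf {n} G = filter (_∈? G) (allFin n)

wordOf-unique : ∀ {n} (G : Subset n) → Unique (wordOf G)
wordOf-unique {n} G = Unique.filter⁺ (_∈? G) (Unique.allFin⁺ n)

∈-wordOf⁻ : ∀ {n} {G : Subset n} {x} → x ∈ₗ wordOf G → x ∈ G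
∈-wordOf⁻ {n} {G} x∈ = proj₂ (∈-filter⁻ (_∈? G) {xs = allFin n} x∈)

length-unique≤∣p∣ : ∀ {n} {xs : List (Fin n)} {p} → Unique xs → All (_∈ p) xs → length xs ≤ ∣ p ∣
length-unique≤∣p∣ [] [] = z≤n
length-unique≤∣p∣ (x∉xs ∷ xs!) (x∈p ∷ xs⊆p) =
  ≤-<-trans (length-unique≤∣p∣ xs! (All.zipWith (λ (y∈p , x≢y) → x∈p∧x≢y⇒x∈p-y y∈p (x≢y ∘ sym)) (xs⊆p , x∉xs)))
            (x∈p⇒∣p-x∣<∣p∣ x∈p)

length-wordOf : ∀ {n} (G : Subset n) → length (wordOf G) ≤ ∣ G ∣
length-wordOf G = length-unique≤∣p∣ (wordOf-unique G) (All.tabulate ∈-wordOf⁻)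

∈-letters⁺ : ∀ {n} {x : Fin n} {w} → x ∈ₗ w → x ∈ letters w
∈-letters⁺ (here refl) = x∈p∪q⁺ (inj₁ (x∈⁅x⁆ _))
∈-letters⁺ (there x∈w) = x∈p∪q⁺ (inj₂ (∈-letters⁺ x∈w))

∈-letters⁻ : ∀ {n} {x : Fin n} w → x ∈ letters w → x ∈ₗ w
∈-letters⁻ [] x∈⊥ = ⊥-elim (∉⊥ x∈⊥)
∈-letters⁻ (y ∷ w) x∈ with x∈p∪q⁻ ⁅ y ⁆ (letters w) x∈
... | inj₁ x∈⁅y⁆ = here (x∈⁅y⁆⇒x≡y y x∈⁅y⁆)
... | inj₂ x∈w = there (∈-letters⁻ w x∈w)

letters-++ : ∀ {n} (v w : Word n) → letters (v ++ w) ≡ letters v ∪ letters w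
letters-++ [] w = sym (∪-identityˡ (letters w))
letters-++ (x ∷ v) w = trans (cong (⁅ x ⁆ ∪_) (letters-++ v w)) (sym (∪-assoc ⁅ x ⁆ (letters v) (letters w)))

letters-wordOf : ∀ {n} (G : Subset n) → letters (wordOf G) ≡ G
letters-wordOf G = ⊆-antisym
  (∈-wordOf⁻ ∘ ∈-letters⁻ (wordOf G))
  (λ x∈G → ∈-letters⁺ (∈-filter⁺ (_∈? G) (∈-allFin _) x∈G))

not-elemB : ∀ {n} (x : Fin n) w → not (elemB x w) ≡ does (all? (λ y → ¬? (x ≟ y)) w)
not-elemB x [] = refl
not-elemB x (y ∷ w) with x ≟ y
... | yes _ = refl
... | no _ = not-elemB x w

noRepeat≡unique? : ∀ {n} (w : Word n) → noRepeat w ≡ does (UniqueDec.unique? _≟_ w)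
noRepeat≡unique? [] = refl
noRepeat≡unique? (x ∷ w) = cong₂ _∧_ (not-elemB x w) (noRepeat≡unique? w)

unique-++ʳ : ∀ {A : Set} (xs : List A) {ys} → Unique (xs ++ ys) → Unique ys
unique-++ʳ [] ys! = ys!
unique-++ʳ (x ∷ xs) (_ ∷ xs++ys!) = unique-++ʳ xs xs++ys!

module _ {n} (Δ : Complex n) where

  feasible-wordOf-++ : ∀ G (β : Word n) → Unique β → (∀ {x} → x ∈ₗ β → x ∉ G) →
    feasible Δ (wordOf G ++ β) ≡ Δ (G ∪ letters β)
  feasible-wordOf-++ G β β! β∉G = cong₂ _∧_
    (trans (noRepeat≡unique? (wordOf G ++ β))
           (dec-true (UniqueDec.unique? _≟_ _) (Unique.++⁺ (wordOf-unique G) β! disjoint)))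
    (cong Δ (trans (letters-++ (wordOf G) β) (cong (_∪ letters β) (letters-wordOf G))))
    where
    disjoint : Disjoint (wordOf G) β
    disjoint (x∈α , x∈β) = β∉G x∈β (∈-wordOf⁻ x∈α)

  feasible-repeat : ∀ α (x : Fin n) → feasible Δ (α ++ x ∷ x ∷ []) ≡ false
  feasible-repeat α x = cong (_∧ Δ (letters (α ++ x ∷ x ∷ [])))
    (trans (noRepeat≡unique? (α ++ x ∷ x ∷ [])) (dec-false (UniqueDec.unique? _≟_ _) repeated))
    where
    repeated : ¬ Unique (α ++ x ∷ x ∷ [])
    repeated α++xx! with unique-++ʳ α α++xx!
    ... | (x≢x ∷ []) ∷ _ = x≢x refl

  cnt-zero : ∀ β → cnt Δ 0 β ≡ (if feasible Δ β then 1 else 0)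
  cnt-zero β rewrite ++-identityʳ β with feasible Δ β
  ... | true = refl
  ... | false = refl

∣p∪q∣≤∣p∣+∣q∣ : ∀ {n} (p q : Subset n) → ∣ p ∪ q ∣ ≤ ∣ p ∣ ℕ.+ ∣ q ∣
∣p∪q∣≤∣p∣+∣q∣ [] [] = z≤n
∣p∪q∣≤∣p∣+∣q∣ (outside ∷ p) (outside ∷ q) = ∣p∪q∣≤∣p∣+∣q∣ p q
∣p∪q∣≤∣p∣+∣q∣ (inside ∷ p) (outside ∷ q) = s≤s (∣p∪q∣≤∣p∣+∣q∣ p q)
∣p∪q∣≤∣p∣+∣q∣ (outside ∷ p) (inside ∷ q) = ≤-trans (s≤s (∣p∪q∣≤∣p∣+∣q∣ p q)) (≤-reflexive (sym (+-suc ∣ p ∣ ∣ q ∣)))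
∣p∪q∣≤∣p∣+∣q∣ (inside ∷ p) (inside ∷ q) = s≤s (≤-trans (∣p∪q∣≤∣p∣+∣q∣ p q) (+-monoʳ-≤ ∣ p ∣ (n≤1+n ∣ q ∣)))

∣p∪⁅x⁆∣≤1+∣p∣ : ∀ {n} (p : Subset n) x → ∣ p ∪ ⁅ x ⁆ ∣ ≤ suc ∣ p ∣
∣p∪⁅x⁆∣≤1+∣p∣ p x = ≤-trans (∣p∪q∣≤∣p∣+∣q∣ p ⁅ x ⁆) (≤-reflexive (trans (cong (∣ p ∣ ℕ.+_) (∣⁅x⁆∣≡1 x)) (+-comm ∣ p ∣ 1)))

x∈p─q⇒x∉q : ∀ {n} {x : Fin n} {p q} → x ∈ p ─ q → x ∉ q
x∈p─q⇒x∉q {p = _ ∷ p} {outside ∷ q} here ()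
x∈p─q⇒x∉q {p = _ ∷ p} {_ ∷ q} (there x∈p─q) (there x∈q) = x∈p─q⇒x∉q x∈p─q x∈q

∃-⊈ : ∀ {n} {p q : Subset n} → ¬ p ⊆ q → ∃[ x ] (x ∈ p × x ∉ q)
∃-⊈ {p = p} {q} p⊈q with any? (λ x → x ∈? p ×-dec ¬? (x ∈? q))
... | yes witness = witness
... | no ∄ = ⊥-elim (p⊈q p⊆q)
  where
  p⊆q : p ⊆ q
  p⊆q {x} x∈p with x ∈? q
  ... | yes x∈q = x∈q
  ... | no x∉q = contradiction (x , x∈p , x∉q) ∄

∪⁅⁆⊆ : ∀ {n} {p q : Subset n} {x} → p ⊆ q → x ∈ q → p ∪ ⁅ x ⁆ ⊆ q
∪⁅⁆⊆ {p = p} {x = x} p⊆q x∈q y∈ with x∈p∪q⁻ p ⁅ x ⁆ y∈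
... | inj₁ y∈p = p⊆q y∈p
... | inj₂ y∈⁅x⁆ = subst (_∈ _) (sym (x∈⁅y⁆⇒x≡y x y∈⁅x⁆)) x∈q

p-x∪⁅x⁆≡p : ∀ {n} {p : Subset n} {x} → x ∈ p → (p - x) ∪ ⁅ x ⁆ ≡ p
p-x∪⁅x⁆≡p {p = p} {x} x∈p = ⊆-antisym (∪⁅⁆⊆ (p─q⊆p p ⁅ x ⁆) x∈p) p⊆
  where
  p⊆ : p ⊆ (p - x) ∪ ⁅ x ⁆
  p⊆ {y} y∈p with y ≟ x
  ... | yes refl = x∈p∪q⁺ (inj₂ (x∈⁅x⁆ x))
  ... | no y≢x = x∈p∪q⁺ (inj₁ (x∈p∧x≢y⇒x∈p-y y∈p y≢x))

∣p∣<∣p∪⁅x⁆∣ : ∀ {n} {p : Subset n} {x} → x ∉ p → ∣ p ∣ < ∣ p ∪ ⁅ x ⁆ ∣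
∣p∣<∣p∪⁅x⁆∣ {x = x} x∉p = p⊂q⇒∣p∣<∣q∣ (p⊆p∪q ⁅ x ⁆ , x , x∈p∪q⁺ (inj₂ (x∈⁅x⁆ x)) , x∉p)

module _ {n} (Δ : Complex n) where

  Augments : Subset n → Subset n → Set
  Augments T S = ∃[ y ] (y ∈ T × y ∉ S × Δ (S ∪ ⁅ y ⁆) ≡ true)

  augments? : ∀ T S → Dec (Augments T S)
  augments? T S = any? λ y → y ∈? T ×-dec ¬? (y ∈? S) ×-dec (Δ (S ∪ ⁅ y ⁆) Bool.≟ true)

record Obstruction {n} (Δ : Complex n) : Set where
  field
    G : Subset n
    s t u : Fin n
    s∉G : s ∉ G
    t∉G : t ∉ G
    u∉G : u ∉ G
    s≢t : s ≢ t
    s≢u : s ≢ u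
    t≢u : t ≢ u
    G+s-face : Δ (G ∪ ⁅ s ⁆) ≡ true
    G+t+u-face : Δ ((G ∪ ⁅ t ⁆) ∪ ⁅ u ⁆) ≡ true
    G+s+t-nonface : Δ ((G ∪ ⁅ s ⁆) ∪ ⁅ t ⁆) ≡ false
    G+s+u-nonface : Δ ((G ∪ ⁅ s ⁆) ∪ ⁅ u ⁆) ≡ false

module Descent {n} {Δ : Complex n} (closed : IsSimplicialComplex Δ) {T} (T-face : Δ T ≡ true) where

  Stuck : Subset n → Set
  Stuck S = Δ S ≡ true × ∣ S ∣ < ∣ T ∣ × ¬ Augments Δ T S

  μ : Subset n → ℕ
  μ S = ∣ S ─ T ∣

  stuck⇒S⊈T : ∀ {S} → Stuck S → ∃[ s ] (s ∈ S × s ∉ T)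
  stuck⇒S⊈T (S-face , S<T , ¬aug) = ∃-⊈ λ S⊆T →
    let (y , y∈T , y∉S) = ∃-⊈ (λ T⊆S → <⇒≱ S<T (p⊆q⇒∣p∣≤∣q∣ T⊆S))
    in ¬aug (y , y∈T , y∉S , closed _ _ (∪⁅⁆⊆ S⊆T y∈T) T-face)

  obstruction-at : ∀ {S s t u} → Stuck S → s ∈ S → s ∉ T → t ∈ T → t ∉ S - s →
    u ∈ T → u ∉ (S - s) ∪ ⁅ t ⁆ → Δ (((S - s) ∪ ⁅ t ⁆) ∪ ⁅ u ⁆) ≡ true → Obstruction Δ
  obstruction-at {S} {s} {t} {u} (S-face , _ , ¬aug) s∈S s∉T t∈T t∉G u∈T u∉H H+u-face = record
    { G = S - s ; s = s ; t = t ; u = u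
    ; s∉G = λ s∈G → x∈p─q⇒x∉q s∈G (x∈⁅x⁆ s)
    ; t∉G = t∉G
    ; u∉G = u∉H ∘ x∈p∪q⁺ ∘ inj₁
    ; s≢t = ∉T⇒≢ t∈T
    ; s≢u = ∉T⇒≢ u∈T
    ; t≢u = λ t≡u → u∉H (x∈p∪q⁺ (inj₂ (subst (_∈ ⁅ t ⁆) t≡u (x∈⁅x⁆ t))))
    ; G+s-face = subst (λ S' → Δ S' ≡ true) (sym G+s≡S) S-face
    ; G+t+u-face = H+u-face
    ; G+s+t-nonface = nonface t∈T t∉G (∉T⇒≢ t∈T ∘ sym)
    ; G+s+u-nonface = nonface u∈T (u∉H ∘ x∈p∪q⁺ ∘ inj₁) (∉T⇒≢ u∈T ∘ sym)
    }
    where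
    G+s≡S : (S - s) ∪ ⁅ s ⁆ ≡ S
    G+s≡S = p-x∪⁅x⁆≡p s∈S
    ∉T⇒≢ : ∀ {y} → y ∈ T → s ≢ y
    ∉T⇒≢ y∈T refl = s∉T y∈T
    nonface : ∀ {y} → y ∈ T → y ∉ S - s → y ≢ s → Δ (((S - s) ∪ ⁅ s ⁆) ∪ ⁅ y ⁆) ≡ false
    nonface {y} y∈T y∉G y≢s = ¬-not λ face →
      ¬aug (y , y∈T , (λ y∈S → y∉G (x∈p∧x≢y⇒x∈p-y y∈S y≢s)) , subst (λ S' → Δ (S' ∪ ⁅ y ⁆) ≡ true) G+s≡S face)

  μ-remove : ∀ {S s} → s ∈ S → s ∉ T → μ (S - s) < μ S
  μ-remove {S} {s} s∈S s∉T =
    subst (λ R → ∣ R ∣ < μ S) (p─q─r≡p─r─q S T ⁅ s ⁆) (x∈p⇒∣p-x∣<∣p∣ (x∈p∧x∉q⇒x∈p─q s∈S s∉T))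

  μ-add : ∀ {S t} → t ∈ T → μ (S ∪ ⁅ t ⁆) ≤ μ S
  μ-add {S} {t} t∈T = p⊆q⇒∣p∣≤∣q∣ H─T⊆S─T
    where
    H─T⊆S─T : (S ∪ ⁅ t ⁆) ─ T ⊆ S ─ T
    H─T⊆S─T {x} x∈H─T with x∈p∪q⁻ S ⁅ t ⁆ (p─q⊆p _ T x∈H─T)
    ... | inj₁ x∈S = x∈p∧x∉q⇒x∈p─q x∈S (x∈p─q⇒x∉q x∈H─T)
    ... | inj₂ x∈⁅t⁆ = contradiction (subst (_∈ T) (sym (x∈⁅y⁆⇒x≡y t x∈⁅t⁆)) t∈T) (x∈p─q⇒x∉q x∈H─T)

  shrink : ∀ {S s} → Stuck S → s ∈ S → s ∉ T → Obstruction Δ ⊎ ∃[ S′ ] (Stuck S′ × μ S′ < μ S)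
  shrink {S} {s} stuck@(S-face , S<T , _) s∈S s∉T with augments? Δ T (S - s)
  ... | no ¬augG = inj₂ (S - s , (G-face , G<T , ¬augG) , μ-remove s∈S s∉T)
    where
    G-face = closed _ _ (p─q⊆p S ⁅ s ⁆) S-face
    G<T = ≤-<-trans (p⊆q⇒∣p∣≤∣q∣ (p─q⊆p S ⁅ s ⁆)) S<T
  ... | yes (t , t∈T , t∉G , G+t-face) with augments? Δ T ((S - s) ∪ ⁅ t ⁆)
  ...   | yes (u , u∈T , u∉H , H+u-face) = inj₁ (obstruction-at stuck s∈S s∉T t∈T t∉G u∈T u∉H H+u-face)
  ...   | no ¬augH = inj₂ (_ , (G+t-face , H<T , ¬augH) , ≤-<-trans (μ-add {S - s} t∈T) (μ-remove s∈S s∉T))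
    where
    H<T = ≤-<-trans (≤-trans (∣p∪⁅x⁆∣≤1+∣p∣ (S - s) t) (x∈p⇒∣p-x∣<∣p∣ s∈S)) S<T

  descend : ∀ {S} → Acc _<_ (μ S) → Stuck S → Obstruction Δ
  descend (acc smaller) stuck with stuck⇒S⊈T stuck
  ... | s , s∈S , s∉T with shrink stuck s∈S s∉T
  ...   | inj₁ o = o
  ...   | inj₂ (_ , stuck′ , μS′<μS) = descend (smaller μS′<μS) stuck′

  stuck⇒obstruction : ∀ {S} → Stuck S → Obstruction Δ
  stuck⇒obstruction {S} = descend (<-wellFounded (μ S))

𝟙 : Bool → ℚ
𝟙 b = ℕtoℚ (if b then 1 else 0)

module _ {n} (Δ : Complex n) {G : Subset n} where

  private
    cnt₀ : ∀ β → Unique β → (∀ {x} → x ∈ₗ β → x ∉ G) →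
      ℕtoℚ (cnt Δ 0 (wordOf G ++ β)) ≡ 𝟙 (Δ (G ∪ letters β))
    cnt₀ β β! β∉G = trans (cong ℕtoℚ (cnt-zero Δ (wordOf G ++ β))) (cong 𝟙 (feasible-wordOf-++ Δ G β β! β∉G))

  Aᴳ : Matrix n
  Aᴳ = Amat Δ (wordOf G) 1

  Aᴳ-∗∗ : Aᴳ nothing nothing ≡ 𝟙 (Δ G)
  Aᴳ-∗∗ = begin
    ℕtoℚ (cnt Δ 0 (wordOf G))      ≡⟨ cong (ℕtoℚ ∘ cnt Δ 0) (sym (++-identityʳ (wordOf G))) ⟩
    ℕtoℚ (cnt Δ 0 (wordOf G ++ [])) ≡⟨ cnt₀ [] [] (λ ()) ⟩
    𝟙 (Δ (G ∪ letters []))          ≡⟨ cong (𝟙 ∘ Δ) (∪-identityʳ G) ⟩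
    𝟙 (Δ G)                         ∎
    where open ≡-Reasoning

  Aᴳ-x∗ : ∀ {x} → x ∉ G → Aᴳ (just x) nothing ≡ 𝟙 (Δ (G ∪ ⁅ x ⁆))
  Aᴳ-x∗ {x} x∉G = trans (cnt₀ [ x ] ([] ∷ []) λ { (here refl) → x∉G })
    (cong (λ X → 𝟙 (Δ (G ∪ X))) (∪-identityʳ ⁅ x ⁆))

  Aᴳ-∗x : ∀ {x} → x ∉ G → Aᴳ nothing (just x) ≡ 𝟙 (Δ (G ∪ ⁅ x ⁆))
  Aᴳ-∗x = Aᴳ-x∗

  Aᴳ-xy : ∀ {x y} → x ∉ G → y ∉ G → x ≢ y → Aᴳ (just x) (just y) ≡ 𝟙 (Δ ((G ∪ ⁅ x ⁆) ∪ ⁅ y ⁆))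
  Aᴳ-xy {x} {y} x∉G y∉G x≢y = trans
    (cnt₀ (x ∷ y ∷ []) ((x≢y ∷ []) ∷ [] ∷ []) λ { (here refl) → x∉G ; (there (here refl)) → y∉G })
    (cong (𝟙 ∘ Δ) (trans (cong (λ Y → G ∪ ⁅ x ⁆ ∪ Y) (∪-identityʳ ⁅ y ⁆)) (sym (∪-assoc G ⁅ x ⁆ ⁅ y ⁆))))

  Aᴳ-xx : ∀ x → Aᴳ (just x) (just x) ≡ 𝟙 false
  Aᴳ-xx x = cong ℕtoℚ (trans (cnt-zero Δ (wordOf G ++ x ∷ x ∷ [])) (cong (if_then 1 else 0) (feasible-repeat Δ (wordOf G) x)))

-- Rows and columns are indexed by (∗, s, t, u) as in Obstruction.
obstructionPattern : Vec (Vec Bool 4) 4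
obstructionPattern =
    (true ∷ true  ∷ true  ∷ true  ∷ [])
  ∷ (true ∷ false ∷ false ∷ false ∷ [])
  ∷ (true ∷ false ∷ false ∷ true  ∷ [])
  ∷ (true ∷ false ∷ true  ∷ false ∷ [])
  ∷ []

pattern-not-hyperbolic : ¬ HyperbolicForm (λ i j → 𝟙 (lookup (lookup obstructionPattern i) j))
pattern-not-hyperbolic hyperbolic = <-irrefl refl (<-≤-trans 0<1 (hyperbolic v w 0<1))
  where
  0<1 = positive⁻¹ 1ℚ
  v = lookup (1ℚ ∷ 1ℚ ∷ - 1ℚ ∷ - 1ℚ ∷ [])
  w = lookup (1ℚ ∷ 0ℚ ∷ 0ℚ ∷ 0ℚ ∷ [])

module _ {n} {Δ : Complex n} (closed : IsSimplicialComplex Δ) (o : Obstruction Δ) where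

  open Obstruction o
  open import Algebra.Properties.CommutativeSemigroup
    (CommutativeMonoid.commutativeSemigroup (∪-commutativeMonoid n)) using (xy∙z≈xz∙y)

  private
    u∉G+t : u ∉ G ∪ ⁅ t ⁆
    u∉G+t u∈ with x∈p∪q⁻ G ⁅ t ⁆ u∈
    ... | inj₁ u∈G = u∉G u∈G
    ... | inj₂ u∈⁅t⁆ = t≢u (sym (x∈⁅y⁆⇒x≡y t u∈⁅t⁆))

    swapped : ∀ {x y b} → Δ ((G ∪ ⁅ x ⁆) ∪ ⁅ y ⁆) ≡ b → Δ ((G ∪ ⁅ y ⁆) ∪ ⁅ x ⁆) ≡ b
    swapped {x} {y} = trans (cong Δ (xy∙z≈xz∙y G ⁅ y ⁆ ⁅ x ⁆))

    G+t-face : Δ (G ∪ ⁅ t ⁆) ≡ true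
    G+t-face = closed _ _ (p⊆p∪q ⁅ u ⁆) G+t+u-face

    G+u-face : Δ (G ∪ ⁅ u ⁆) ≡ true
    G+u-face = closed _ _ (p⊆p∪q ⁅ t ⁆) (swapped G+t+u-face)

    G-face : Δ G ≡ true
    G-face = closed _ _ (p⊆p∪q ⁅ t ⁆) G+t-face

  points : Vec (Xbar n) 4
  points = nothing ∷ just s ∷ just t ∷ just u ∷ []

  points-injective : Injective _≡_ _≡_ (lookup points)
  points-injective {i} {j} = lookup-injective
    ( ((λ ()) ∷ (λ ()) ∷ (λ ()) ∷ [])
    ∷ ((s≢t ∘ just-injective) ∷ (s≢u ∘ just-injective) ∷ [])
    ∷ ((t≢u ∘ just-injective) ∷ [])
    ∷ [] ∷ []) i j

  pattern ∗ᵢ = zero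
  pattern sᵢ = suc zero
  pattern tᵢ = suc (suc zero)
  pattern uᵢ = suc (suc (suc zero))

  restricted-Aᴳ : ∀ i j → Aᴳ Δ {G} (lookup points i) (lookup points j) ≡ 𝟙 (lookup (lookup obstructionPattern i) j)
  restricted-Aᴳ ∗ᵢ ∗ᵢ = trans (Aᴳ-∗∗ Δ) (cong 𝟙 G-face)
  restricted-Aᴳ ∗ᵢ sᵢ = trans (Aᴳ-∗x Δ s∉G) (cong 𝟙 G+s-face)
  restricted-Aᴳ ∗ᵢ tᵢ = trans (Aᴳ-∗x Δ t∉G) (cong 𝟙 G+t-face)
  restricted-Aᴳ ∗ᵢ uᵢ = trans (Aᴳ-∗x Δ u∉G) (cong 𝟙 G+u-face)
  restricted-Aᴳ sᵢ ∗ᵢ = trans (Aᴳ-x∗ Δ s∉G) (cong 𝟙 G+s-face)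
  restricted-Aᴳ tᵢ ∗ᵢ = trans (Aᴳ-x∗ Δ t∉G) (cong 𝟙 G+t-face)
  restricted-Aᴳ uᵢ ∗ᵢ = trans (Aᴳ-x∗ Δ u∉G) (cong 𝟙 G+u-face)
  restricted-Aᴳ sᵢ sᵢ = Aᴳ-xx Δ s
  restricted-Aᴳ tᵢ tᵢ = Aᴳ-xx Δ t
  restricted-Aᴳ uᵢ uᵢ = Aᴳ-xx Δ u
  restricted-Aᴳ sᵢ tᵢ = trans (Aᴳ-xy Δ s∉G t∉G s≢t) (cong 𝟙 G+s+t-nonface)
  restricted-Aᴳ tᵢ sᵢ = trans (Aᴳ-xy Δ t∉G s∉G (s≢t ∘ sym)) (cong 𝟙 (swapped G+s+t-nonface))
  restricted-Aᴳ sᵢ uᵢ = trans (Aᴳ-xy Δ s∉G u∉G s≢u) (cong 𝟙 G+s+u-nonface)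
  restricted-Aᴳ uᵢ sᵢ = trans (Aᴳ-xy Δ u∉G s∉G (s≢u ∘ sym)) (cong 𝟙 (swapped G+s+u-nonface))
  restricted-Aᴳ tᵢ uᵢ = trans (Aᴳ-xy Δ t∉G u∉G t≢u) (cong 𝟙 G+t+u-face)
  restricted-Aᴳ uᵢ tᵢ = trans (Aᴳ-xy Δ u∉G t∉G (t≢u ∘ sym)) (cong 𝟙 (swapped G+t+u-face))

  below-rank : BelowRank Δ (suc ∣ G ∣)
  below-rank = _ , G+t+u-face , ≤-<-trans (∣p∣<∣p∪⁅x⁆∣ t∉G) (∣p∣<∣p∪⁅x⁆∣ u∉G+t)

  obstruction-not-hyperbolic : ¬ AtlasHyperbolic Δ (suc ∣ G ∣)
  obstruction-not-hyperbolic (_ , hyperbolic₁) = pattern-not-hyperbolic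
    (restrict-hyperbolic (Aᴳ Δ {G}) points-injective (hyperbolic₁ (wordOf G) (length-wordOf G)) restricted-Aᴳ)

theorem4p9 : (n : ℕ) (Δ : Complex n) → IsSimplicialComplex Δ →
    ((k : ℕ) → 1 ≤ k → BelowRank Δ k → AtlasHyperbolic Δ k) →
    IsMatroid Δ
theorem4p9 n Δ closed hyperbolic S T S-face T-face S<T =
  decidable-stable (augments? Δ T S) λ ¬augmentation →
    let o = Descent.stuck⇒obstruction closed T-face (S-face , S<T , ¬augmentation)
    in obstruction-not-hyperbolic closed o (hyperbolic (suc ∣ Obstruction.G o ∣) (s≤s z≤n) (below-rank closed o))
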